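{- Let $\Sigma$ be a CoLF signature. For any rational terms $M$ and $M'$ (terms all of whose recursion constants are declared in $\Sigma$), any list of distinct variables $\Theta$ and any finite list of assumptions $\Delta$, it is decidable whether the equality judgment $\Delta;\Theta\vdash_\Sigma M = M'$ is derivable.
   Context: CoLF syntax. A signature $\Sigma$ is a list of declarations $a:K$ (type families), $c:A$ (constructors) and $r:A=M$ (recursion constants with their definitions; definitions may mention recursion constants declared anywhere in $\Sigma$). Kinds $K::=\mathsf{type}\mid\mathsf{cotype}\mid \Pi x{:}A.\,K\mid \Pi x\,\hat{:}\,A.\,K$; types $A::=P\mid \Pi x{:}A_2.\,A_1\mid \Pi x\,\hat{:}\,A_2.\,A_1$ (the $\hat{:}$ forms are prepattern $\Pi$'s); atomic types $P::=a\cdot S$; canonical terms $M::=R\mid \lambda x.\,M$; neutral terms $R::=H\cdot S$; heads $H::=x\mid c\mid r$; spines $S::=()\mid M;S\mid [x];S$, where $[x]$ is a prepattern argument consisting of a variable. A spine is prepattern ($S\ \mathsf{prepat}$) if it consists only of prepattern arguments $[x]$. A term is contractive ($M\ \mathsf{contra}$) if its head (under its $\lambda$'s) is a constructor or a variable, not a recursion constant. Simple types $\tau::=*\mid\tau_1\to\tau_2$, with erasure $(\Pi x{:}A_2.A_1)^o=A_2^o\to A_1^o$, $(\Pi x\,\hat{:}\,A_2.A_1)^o=*\to A_1^o$, $P^o=*$. The renaming $\{y/x\}M$ replaces variable $x$ by variable $y$ (also turning $[x]$ into $[y]$). Hereditary substitution $[N/x]^\tau$ is the partial operation: $[N/x]^\tau(\lambda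 y.M)=\lambda y.[N/x]^\tau M$ ($y\neq x$, $y$ not free in $N$); $[N/x]^\tau(x\cdot S)=([N/x]^\tau S)\rhd^\tau N$; $[N/x]^\tau(H\cdot S)=H\cdot[N/x]^\tau S$ for $H\ne x$; on spines componentwise, with $[N/x]^\tau([x];S)$ undefined and $[N/x]^\tau([z];S)=[z];[N/x]^\tau S$ for $z\neq x$; and $()\rhd^* R=R$, $(N;S)\rhd^{\tau_2\to\tau_1}(\lambda x.M)=S\rhd^{\tau_1}([N/x]^{\tau_2}M)$, $([y];S)\rhd^{*\to\tau_1}(\lambda x.M)=S\rhd^{\tau_1}(\{y/x\}M)$, undefined otherwise. Equality judgment. $\Theta$ is a list of distinct variables; $\Delta$ is a list of assumptions $\Theta'\vdash H\cdot S_1\doteq H'\cdot S_2$. A renaming $\sigma$ from $\Theta'$ to $\Theta$ (written $\Theta\vdash\sigma:\Theta'$) maps variables of $\Theta'$ to variables of $\Theta$. Rules for $\Delta;\Theta\vdash_\Sigma M=M'$: (1) if $\Theta'\vdash H\cdot S_1\doteq H'\cdot S_2$ is in $\Delta$ and $\Theta\vdash\sigma:\Theta'$, then $\Delta;\Theta\vdash_\Sigma \sigma(H\cdot S_1)=\sigma(H'\cdot S_2)$; (2) if $r:A=M\in\Sigma$, $S_1\ \mathsf{prepat}$, $M\ \mathsf{contra}$ and $\Delta,(\Theta\vdash r\cdot S_1\doteq H\cdot S_2);\Theta\vdash_\Sigma S_1\rhd^{A^o}M=H\cdot S_2$, then $\Delta;\Theta\vdash_\Sigma r\cdot S_1=H\cdot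 S_2$; (3) if $r:A=M\in\Sigma$, $S_2\ \mathsf{prepat}$, $M\ \mathsf{contra}$, $H$ is not a recursion constant, and $\Delta,(\Theta\vdash H\cdot S_1\doteq r\cdot S_2);\Theta\vdash_\Sigma H\cdot S_1=S_2\rhd^{A^o}M$, then $\Delta;\Theta\vdash_\Sigma H\cdot S_1=r\cdot S_2$; (4) $c\cdot S=c\cdot S'$ from $S=S'$; (5) $y\cdot S=y\cdot S'$ from $S=S'$; (6) $\Delta;\Theta\vdash_\Sigma\lambda x.M=\lambda x.M'$ from $\Delta;\Theta,x\vdash_\Sigma M=M'$. Spine equality $\Delta;\Theta\vdash_\Sigma S=S'$: $()=()$; $M;S=M';S'$ from $M=M'$ and $S=S'$; $[x];S=[x];S'$ from $S=S'$. -}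

module Defs where

open import Data.Nat using (ℕ; zero; suc)
open import Data.Fin using (Fin; zero; suc; punchOut; _≟_)
open import Data.List using (List; []; _∷_)
open import Data.List.Membership.Propositional using (_∈_)
open import Data.Maybe using (Maybe; just; nothing)
open import Data.Product using (∃; ∃₂; _,_)
open import Relation.Nullary using (yes; no)
open import Relation.Binary.PropositionalEquality using (_≡_)

-- A term of type  Tm n  has its free variables among the n variables of
-- the context Θ (a list of n distinct variables; Fin n names them).

data Head (n : ℕ) : Set where
  var  : Fin n → Head n
  con  : ℕ → Head n
  rcon : ℕ → Head n

mutual
  data Tm (n : ℕ) : Set where
    lam : Tm (suc n) → Tm n
    neu : Head n → Spine n → Tm n

  -- spines  S ::= () | M ; S | [x] ; S
  data Spine (n : ℕ) : Set where
    nil : Spine n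
    app : Tm n → Spine n → Spine n
    pv  : Fin n → Spine n → Spine n

-- types  A ::= a · S | Πx:A₂.A₁ | Πx^:A₂.A₁
data Tp (n : ℕ) : Set where
  atom : ℕ → Spine n → Tp n
  Pi   : Tp n → Tp (suc n) → Tp n
  PiP  : Tp n → Tp (suc n) → Tp n

-- kinds  K ::= type | cotype | Πx:A.K | Πx^:A.K
data Kind (n : ℕ) : Set where
  type   : Kind n
  cotype : Kind n
  PiK    : Tp n → Kind (suc n) → Kind n
  PiPK   : Tp n → Kind (suc n) → Kind n

data Decl : Set where
  famDecl : ℕ → Kind 0 → Decl
  conDecl : ℕ → Tp 0 → Decl
  recDecl : ℕ → Tp 0 → Tm 0 → Decl

Signature : Set
Signature = List Decl

data STy : Set where
  * : STy
  _⇒_ : STy → STy → STy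

erase : ∀ {n} → Tp n → STy
erase (atom _ _) = *
erase (Pi A₂ A₁) = erase A₂ ⇒ erase A₁
erase (PiP A₂ A₁) = * ⇒ erase A₁

Ren : ℕ → ℕ → Set
Ren n m = Fin n → Fin m

liftR : ∀ {n m} → Ren n m → Ren (suc n) (suc m)
liftR σ zero = zero
liftR σ (suc i) = suc (σ i)

renH : ∀ {n m} → Ren n m → Head n → Head m
renH σ (var x) = var (σ x)
renH σ (con c) = con c
renH σ (rcon r) = rcon r

mutual
  renTm : ∀ {n m} → Ren n m → Tm n → Tm m
  renTm σ (lam M) = lam (renTm (liftR σ) M)
  renTm σ (neu H S) = neu (renH σ H) (renSp σ S)

  renSp : ∀ {n m} → Ren n m → Spine n → Spine m
  renSp σ nil = nil
  renSp σ (app M S) = app (renTm σ M) (renSp σ S)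
  renSp σ (pv x S) = pv (σ x) (renSp σ S)

single : ∀ {n} → Fin n → Ren (suc n) n
single y zero = y
single y (suc i) = i

weaken0 : ∀ {n} → Tm 0 → Tm n
weaken0 = renTm (λ ())

-- Hereditary substitution [N/x]^τ (partial, hence Maybe) and S ▷^τ M.

mutual
  hsub : ∀ {n} → STy → Tm n → Fin (suc n) → Tm (suc n) → Maybe (Tm n)
  hsub τ N x (lam M) with hsub τ (renTm suc N) (suc x) M
  ... | just M' = just (lam M')
  ... | nothing = nothing
  hsub τ N x (neu (var y) S) with x ≟ y
  ... | yes _ with hsubSp τ N x S
  ...   | just S' = hred τ S' N
  ...   | nothing = nothing
  hsub τ N x (neu (var y) S) | no x≢y with hsubSp τ N x S
  ...   | just S' = just (neu (var (punchOut x≢y)) S')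
  ...   | nothing = nothing
  hsub τ N x (neu (con c) S) with hsubSp τ N x S
  ... | just S' = just (neu (con c) S')
  ... | nothing = nothing
  hsub τ N x (neu (rcon r) S) with hsubSp τ N x S
  ... | just S' = just (neu (rcon r) S')
  ... | nothing = nothing

  hsubSp : ∀ {n} → STy → Tm n → Fin (suc n) → Spine (suc n) → Maybe (Spine n)
  hsubSp τ N x nil = just nil
  hsubSp τ N x (app M S) with hsub τ N x M | hsubSp τ N x S
  ... | just M' | just S' = just (app M' S')
  ... | _ | _ = nothing
  hsubSp τ N x (pv z S) with x ≟ z
  ... | yes _ = nothing
  ... | no x≢z with hsubSp τ N x S
  ...   | just S' = just (pv (punchOut x≢z) S')
  ...   | nothing = nothing

  hred : ∀ {n} → STy → Spine n → Tm n → Maybe (Tm n)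
  hred * nil (neu H S) = just (neu H S)
  hred (τ₂ ⇒ τ₁) (app N S) (lam M) with hsub τ₂ N zero M
  ... | just M' = hred τ₁ S M'
  ... | nothing = nothing
  hred (* ⇒ τ₁) (pv y S) (lam M) = hred τ₁ S (renTm (single y) M)
  hred _ _ _ = nothing

data Prepat {n : ℕ} : Spine n → Set where
  nil : Prepat nil
  pv  : ∀ {x S} → Prepat S → Prepat (pv x S)

data Contra {n : ℕ} : Tm n → Set where
  lam : ∀ {M} → Contra M → Contra (lam M)
  con : ∀ {c S} → Contra (neu (con c) S)
  var : ∀ {x S} → Contra (neu (var x) S)

data NotRec {n : ℕ} : Head n → Set where
  var : ∀ {x} → NotRec (var x)
  con : ∀ {c} → NotRec (con c)

-- Assumptions  Θ' ⊢ H·S₁ ≐ H'·S₂  (Θ' has n' variables)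

data Assumption : Set where
  asm : (n' : ℕ) → Head n' → Spine n' → Head n' → Spine n' → Assumption

-- Equality judgment  Δ ; Θ ⊢_Σ M = M'   (Θ of length n)
-- Δ, a is represented as  a ∷ Δ  (only membership in Δ matters).

mutual
  data EqTm (Sg : Signature) : List Assumption → (n : ℕ) → Tm n → Tm n → Set where
    eq-hyp : ∀ {Δ n n' H S₁ H' S₂} →
             asm n' H S₁ H' S₂ ∈ Δ → (σ : Ren n' n) →
             EqTm Sg Δ n (renTm σ (neu H S₁)) (renTm σ (neu H' S₂))
    eq-unfoldL : ∀ {Δ n r A M S₁ H S₂ T} →
             recDecl r A M ∈ Sg → Prepat S₁ → Contra M →
             hred (erase A) S₁ (weaken0 M) ≡ just T →
             EqTm Sg (asm n (rcon r) S₁ H S₂ ∷ Δ) n T (neu H S₂) →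
             EqTm Sg Δ n (neu (rcon r) S₁) (neu H S₂)
    eq-unfoldR : ∀ {Δ n r A M S₁ H S₂ T} →
             recDecl r A M ∈ Sg → Prepat S₂ → Contra M → NotRec H →
             hred (erase A) S₂ (weaken0 M) ≡ just T →
             EqTm Sg (asm n H S₁ (rcon r) S₂ ∷ Δ) n (neu H S₁) T →
             EqTm Sg Δ n (neu H S₁) (neu (rcon r) S₂)
    eq-con : ∀ {Δ n c S S'} → EqSp Sg Δ n S S' →
             EqTm Sg Δ n (neu (con c) S) (neu (con c) S')
    eq-var : ∀ {Δ n y S S'} → EqSp Sg Δ n S S' →
             EqTm Sg Δ n (neu (var y) S) (neu (var y) S')
    eq-lam : ∀ {Δ n M M'} → EqTm Sg Δ (suc n) M M' →
             EqTm Sg Δ n (lam M) (lam M')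

  data EqSp (Sg : Signature) : List Assumption → (n : ℕ) → Spine n → Spine n → Set where
    eq-nil : ∀ {Δ n} → EqSp Sg Δ n nil nil
    eq-app : ∀ {Δ n M M' S S'} → EqTm Sg Δ n M M' → EqSp Sg Δ n S S' →
             EqSp Sg Δ n (app M S) (app M' S')
    eq-pv  : ∀ {Δ n x S S'} → EqSp Sg Δ n S S' →
             EqSp Sg Δ n (pv x S) (pv x S')

Declared : Signature → ℕ → Set
Declared Sg r = ∃₂ λ A M → recDecl r A M ∈ Sg

mutual
  data RatTm (Sg : Signature) {n : ℕ} : Tm n → Set where
    lam  : ∀ {M} → RatTm Sg M → RatTm Sg (lam M)
    var  : ∀ {x S} → RatSp Sg S → RatTm Sg (neu (var x) S)
    con  : ∀ {c S} → RatSp Sg S → RatTm Sg (neu (con c) S)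
    rcon : ∀ {r S} → Declared Sg r → RatSp Sg S → RatTm Sg (neu (rcon r) S)

  data RatSp (Sg : Signature) {n : ℕ} : Spine n → Set where
    nil : RatSp Sg nil
    app : ∀ {M S} → RatTm Sg M → RatSp Sg S → RatSp Sg (app M S)
    pv  : ∀ {x S} → RatSp Sg S → RatSp Sg (pv x S)

WellScopedSig : Signature → Set
WellScopedSig Sg = ∀ {r A M} → recDecl r A M ∈ Sg → RatTm Sg M

-- A neutral pair that is an instance of an assumption is equal by rule (1);
-- otherwise the heads select at most one further rule, so the rules read as a
-- search procedure. It terminates because every term it meets is a renaming of
-- a subterm of M, M' or of a definition body (unfolding along a prepattern
-- spine only renames variables). Pairs of such terms, renamed into a common
-- context of size at most one more than their combined contexts, form a finite
-- set of patterns, and whether a pair is an instance of an assumption depends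
-- only on its pattern. Rules (2) and (3) are tried only on pairs that are not
-- yet instances and add them as assumptions, so each unfolding strictly
-- decreases the number of uncovered patterns.

module Submission where

open import Defs
open import Data.Nat as ℕ using (ℕ; zero; suc; _+_; _≤_; _<_; z≤n; s≤s)
open import Data.Nat.Properties using (m≤n⇒m≤1+n)
open import Data.Nat.Induction using (<-wellFounded)
open import Data.Fin as Fin using (Fin; zero; suc; _↑ˡ_; _↑ʳ_)
open import Data.Fin.Properties using (any?; ¬Fin0)
import Data.Vec.Functional as Vec
open import Data.Vec.Functional.Properties using (lookup-++ˡ; lookup-++ʳ)
open import Data.Product using (Σ; ∃; _×_; _,_; proj₁; proj₂; uncurry)
open import Data.Sum using (_⊎_; inj₁; inj₂; [_,_]′)
open import Data.Empty using (⊥-elim)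
open import Data.Maybe using (just; nothing)
open import Data.Maybe.Properties using (just-injective)
open import Data.List using (List; []; _∷_; _++_; map; concatMap; allFin; cartesianProduct)
open import Data.List.Membership.Propositional using (_∈_; lose)
open import Data.List.Membership.Propositional.Properties
  using (∈-++⁺ˡ; ∈-++⁺ʳ; ∈-++⁻; ∈-map⁺; ∈-concatMap⁺; ∈-concatMap⁻; ∈-allFin; ∈-cartesianProduct⁺)
open import Data.List.Relation.Unary.Any as Any using (Any; here; there; satisfied)
open import Function using (_∘_)
open import Function.Bundles using (_⇔_; mk⇔; Equivalence)
open import Induction.WellFounded using (Acc; acc)
open import Relation.Nullary using (Dec; yes; no; ¬_)
open import Relation.Nullary.Decidable using (map′; _×-dec_; _⊎-dec_)
open import Relation.Binary.PropositionalEquality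

_≟ᴴ_ : ∀ {n} (H H' : Head n) → Dec (H ≡ H')
var x ≟ᴴ var y with x Fin.≟ y
... | yes refl = yes refl
... | no x≢y = no λ { refl → x≢y refl }
con c ≟ᴴ con d with c ℕ.≟ d
... | yes refl = yes refl
... | no c≢d = no λ { refl → c≢d refl }
rcon r ≟ᴴ rcon s with r ℕ.≟ s
... | yes refl = yes refl
... | no r≢s = no λ { refl → r≢s refl }
var _ ≟ᴴ con _ = no λ ()
var _ ≟ᴴ rcon _ = no λ ()
con _ ≟ᴴ var _ = no λ ()
con _ ≟ᴴ rcon _ = no λ ()
rcon _ ≟ᴴ var _ = no λ ()
rcon _ ≟ᴴ con _ = no λ ()

mutual
  _≟ᵀ_ : ∀ {n} (M M' : Tm n) → Dec (M ≡ M')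
  lam M ≟ᵀ lam M' with M ≟ᵀ M'
  ... | yes refl = yes refl
  ... | no M≢M' = no λ { refl → M≢M' refl }
  neu H S ≟ᵀ neu H' S' with H ≟ᴴ H' | S ≟ˢ S'
  ... | yes refl | yes refl = yes refl
  ... | no H≢H' | _ = no λ { refl → H≢H' refl }
  ... | _ | no S≢S' = no λ { refl → S≢S' refl }
  lam _ ≟ᵀ neu _ _ = no λ ()
  neu _ _ ≟ᵀ lam _ = no λ ()

  _≟ˢ_ : ∀ {n} (S S' : Spine n) → Dec (S ≡ S')
  nil ≟ˢ nil = yes refl
  app M S ≟ˢ app M' S' with M ≟ᵀ M' | S ≟ˢ S'
  ... | yes refl | yes refl = yes refl
  ... | no M≢M' | _ = no λ { refl → M≢M' refl }
  ... | _ | no S≢S' = no λ { refl → S≢S' refl }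
  pv x S ≟ˢ pv y S' with x Fin.≟ y | S ≟ˢ S'
  ... | yes refl | yes refl = yes refl
  ... | no x≢y | _ = no λ { refl → x≢y refl }
  ... | _ | no S≢S' = no λ { refl → S≢S' refl }
  nil ≟ˢ app _ _ = no λ ()
  nil ≟ˢ pv _ _ = no λ ()
  app _ _ ≟ˢ nil = no λ ()
  app _ _ ≟ˢ pv _ _ = no λ ()
  pv _ _ ≟ˢ nil = no λ ()
  pv _ _ ≟ˢ app _ _ = no λ ()

prepat? : ∀ {n} (S : Spine n) → Dec (Prepat S)
prepat? nil = yes nil
prepat? (app M S) = no λ ()
prepat? (pv x S) = map′ pv (λ { (pv p) → p }) (prepat? S)

contra? : ∀ {n} (M : Tm n) → Dec (Contra M)
contra? (lam M) = map′ lam (λ { (lam c) → c }) (contra? M)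
contra? (neu (var x) S) = yes var
contra? (neu (con c) S) = yes con
contra? (neu (rcon r) S) = no λ ()

liftR-comp : ∀ {a b c} {σ : Ren b c} {ρ : Ren a b} {τ : Ren a c} →
             σ ∘ ρ ≗ τ → liftR σ ∘ liftR ρ ≗ liftR τ
liftR-comp h zero = refl
liftR-comp h (suc i) = cong suc (h i)

renH-comp : ∀ {a b c} {σ : Ren b c} {ρ : Ren a b} {τ : Ren a c} →
            σ ∘ ρ ≗ τ → ∀ H → renH σ (renH ρ H) ≡ renH τ H
renH-comp h (var x) = cong var (h x)
renH-comp h (con c) = refl
renH-comp h (rcon r) = refl

mutual
  renTm-comp : ∀ {a b c} {σ : Ren b c} {ρ : Ren a b} {τ : Ren a c} →
               σ ∘ ρ ≗ τ → ∀ M → renTm σ (renTm ρ M) ≡ renTm τ M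
  renTm-comp h (lam M) = cong lam (renTm-comp (liftR-comp h) M)
  renTm-comp h (neu H S) = cong₂ neu (renH-comp h H) (renSp-comp h S)

  renSp-comp : ∀ {a b c} {σ : Ren b c} {ρ : Ren a b} {τ : Ren a c} →
               σ ∘ ρ ≗ τ → ∀ S → renSp σ (renSp ρ S) ≡ renSp τ S
  renSp-comp h nil = refl
  renSp-comp h (app M S) = cong₂ app (renTm-comp h M) (renSp-comp h S)
  renSp-comp h (pv x S) = cong₂ pv (h x) (renSp-comp h S)

liftR-id : ∀ {a} {σ : Ren a a} → σ ≗ (λ i → i) → liftR σ ≗ (λ i → i)
liftR-id h zero = refl
liftR-id h (suc i) = cong suc (h i)

mutual
  renTm-id : ∀ {a} {σ : Ren a a} → σ ≗ (λ i → i) → ∀ M → renTm σ M ≡ M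
  renTm-id h (lam M) = cong lam (renTm-id (liftR-id h) M)
  renTm-id h (neu (var x) S) = cong₂ neu (cong var (h x)) (renSp-id h S)
  renTm-id h (neu (con c) S) = cong (neu (con c)) (renSp-id h S)
  renTm-id h (neu (rcon r) S) = cong (neu (rcon r)) (renSp-id h S)

  renSp-id : ∀ {a} {σ : Ren a a} → σ ≗ (λ i → i) → ∀ S → renSp σ S ≡ S
  renSp-id h nil = refl
  renSp-id h (app M S) = cong₂ app (renTm-id h M) (renSp-id h S)
  renSp-id h (pv x S) = cong₂ pv (h x) (renSp-id h S)

renTm-cong : ∀ {a b} {σ τ : Ren a b} → σ ≗ τ → ∀ M → renTm σ M ≡ renTm τ M
renTm-cong {σ = σ} h M = trans (sym (renTm-id (λ _ → refl) (renTm σ M))) (renTm-comp h M)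

functions : ∀ a b → List (Fin a → Fin b)
functions zero b = (λ ()) ∷ []
functions (suc a) b = concatMap (λ j → map (j Vec.∷_) (functions a b)) (allFin b)

functions-complete : ∀ {a b} (f : Fin a → Fin b) → ∃ λ g → g ∈ functions a b × f ≗ g
functions-complete {zero} f = _ , here refl , λ ()
functions-complete {suc a} {b} f with functions-complete (f ∘ suc)
... | g , g∈ , f∘suc≗g =
  f zero Vec.∷ g ,
  ∈-concatMap⁺ (λ j → map (j Vec.∷_) (functions a b)) (lose (∈-allFin (f zero)) (∈-map⁺ (f zero Vec.∷_) g∈)) ,
  λ { zero → refl ; (suc i) → f∘suc≗g i }

∃-function? : ∀ {a b} {P : (Fin a → Fin b) → Set} →
              (∀ {f g} → f ≗ g → P f → P g) → (∀ f → Dec (P f)) → Dec (∃ P)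
∃-function? {a} {b} resp P? = map′ satisfied complete (Any.any? P? (functions a b))
  where
  complete : ∃ _ → Any _ (functions a b)
  complete (f , p) with functions-complete f
  ... | g , g∈ , f≗g = lose g∈ (resp f≗g p)

∃∈? : ∀ {A : Set} {P : A → Set} (xs : List A) →
      (∀ {x} → x ∈ xs → Dec (P x)) → Dec (∃ λ x → x ∈ xs × P x)
∃∈? [] P? = no λ { (_ , () , _) }
∃∈? (x ∷ xs) P? with P? (here refl) | ∃∈? xs (P? ∘ there)
... | yes p | _ = yes (x , here refl , p)
... | no _ | yes (y , y∈ , p) = yes (y , there y∈ , p)
... | no ¬p | no ¬q = no λ { (_ , here refl , p) → ¬p p ; (y , there y∈ , p) → ¬q (y , y∈ , p) }

-- ρ factors through a context of size suc M, with back a section of out on the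
-- image of ρ; size M is needed only when n = 0, as then Fin (suc M) has no map to Fin n.
record Factorisation {M n : ℕ} (ρ : Ren M n) : Set where
  field
    size       : ℕ
    size-bound : size ≡ M ⊎ size ≡ suc M
    back       : Ren n size
    out        : Ren size n
    retract    : out ∘ back ∘ ρ ≗ ρ

factorise : ∀ {M n} (ρ : Ren M n) → Factorisation ρ
factorise {M} {zero} ρ = record
  { size = M ; size-bound = inj₁ refl ; back = λ () ; out = ρ ; retract = λ i → ⊥-elim (¬Fin0 (ρ i)) }
factorise {M} {suc n} ρ = record
  { size = suc M ; size-bound = inj₂ refl ; back = back ; out = zero Vec.∷ ρ ; retract = retract }
  where
  back : Ren (suc n) (suc M)
  back v with any? (λ j → ρ j Fin.≟ v)
  ... | yes (j , _) = suc j
  ... | no _ = zero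

  retract : (zero Vec.∷ ρ) ∘ back ∘ ρ ≗ ρ
  retract i with any? (λ j → ρ j Fin.≟ ρ i)
  ... | yes (j , ρj≡ρi) = ρj≡ρi
  ... | no ¬∃ = ⊥-elim (¬∃ (i , refl))

data Assumed (Δ : List Assumption) {n : ℕ} (u₁ u₂ : Tm n) : Set where
  assumed : ∀ {n' H S₁ H' S₂} → asm n' H S₁ H' S₂ ∈ Δ → (σ : Ren n' n) →
            renTm σ (neu H S₁) ≡ u₁ → renTm σ (neu H' S₂) ≡ u₂ → Assumed Δ u₁ u₂

Assumed-∷ : ∀ {Δ a n} {u₁ u₂ : Tm n} → Assumed Δ u₁ u₂ → Assumed (a ∷ Δ) u₁ u₂
Assumed-∷ (assumed a∈ σ e₁ e₂) = assumed (there a∈) σ e₁ e₂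

Assumed-head : ∀ {Δ n H S₁ H' S₂} → Assumed (asm n H S₁ H' S₂ ∷ Δ) (neu H S₁) (neu H' S₂)
Assumed-head {H = H} {S₁} {H'} {S₂} =
  assumed (here refl) (λ i → i) (renTm-id (λ _ → refl) (neu H S₁)) (renTm-id (λ _ → refl) (neu H' S₂))

Assumed-reindex : ∀ {Δ m₁ m₂ n n'} {t₁ : Tm m₁} {t₂ : Tm m₂}
                  {ρ₁ : Ren m₁ n} {ρ₂ : Ren m₂ n} {ρ₁' : Ren m₁ n'} {ρ₂' : Ren m₂ n'} (π : Ren n n') →
                  π ∘ ρ₁ ≗ ρ₁' → π ∘ ρ₂ ≗ ρ₂' →
                  Assumed Δ (renTm ρ₁ t₁) (renTm ρ₂ t₂) → Assumed Δ (renTm ρ₁' t₁) (renTm ρ₂' t₂)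
Assumed-reindex π h₁ h₂ (assumed a∈ σ e₁ e₂) =
  assumed a∈ (π ∘ σ) (move e₁ h₁) (move e₂ h₂)
  where
  move : ∀ {m s} {t : Tm m} {ρ ρ'} → renTm σ s ≡ renTm ρ t → π ∘ ρ ≗ ρ' →
         renTm (π ∘ σ) s ≡ renTm ρ' t
  move {s = s} {t} {ρ} {ρ'} e h = begin
    renTm (π ∘ σ) s      ≡⟨ renTm-comp (λ _ → refl) s ⟨
    renTm π (renTm σ s)  ≡⟨ cong (renTm π) e ⟩
    renTm π (renTm ρ t)  ≡⟨ renTm-comp h t ⟩
    renTm ρ' t           ∎
    where open ≡-Reasoning

assumed? : ∀ Δ {n} (u₁ u₂ : Tm n) → Dec (Assumed Δ u₁ u₂)
assumed? [] u₁ u₂ = no λ { (assumed () _ _ _) }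
assumed? (asm n' H S₁ H' S₂ ∷ Δ) u₁ u₂ =
  map′ [ (λ (σ , e₁ , e₂) → assumed (here refl) σ e₁ e₂) , Assumed-∷ ]′ split
       (instance? ⊎-dec assumed? Δ u₁ u₂)
  where
  Instance : Ren n' _ → Set
  Instance σ = renTm σ (neu H S₁) ≡ u₁ × renTm σ (neu H' S₂) ≡ u₂

  instance? : Dec (∃ Instance)
  instance? = ∃-function?
    (λ σ≗τ (e₁ , e₂) → trans (sym (renTm-cong σ≗τ (neu H S₁))) e₁ , trans (sym (renTm-cong σ≗τ (neu H' S₂))) e₂)
    (λ σ → (renTm σ (neu H S₁) ≟ᵀ u₁) ×-dec (renTm σ (neu H' S₂) ≟ᵀ u₂))

  split : Assumed (asm n' H S₁ H' S₂ ∷ Δ) u₁ u₂ → ∃ Instance ⊎ Assumed Δ u₁ u₂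
  split (assumed (here refl) σ e₁ e₂) = inj₁ (σ , e₁ , e₂)
  split (assumed (there a∈) σ e₁ e₂) = inj₂ (assumed a∈ σ e₁ e₂)

SomeTm : Set
SomeTm = Σ ℕ Tm

mutual
  subterms : ∀ {m} → Tm m → List SomeTm
  subterms {m} (lam M) = (m , lam M) ∷ subterms M
  subterms {m} (neu H S) = (m , neu H S) ∷ subtermsSp S

  subtermsSp : ∀ {m} → Spine m → List SomeTm
  subtermsSp nil = []
  subtermsSp (app M S) = subterms M ++ subtermsSp S
  subtermsSp (pv x S) = subtermsSp S

∈-subterms-self : ∀ {m} (M : Tm m) → (m , M) ∈ subterms M
∈-subterms-self (lam M) = here refl
∈-subterms-self (neu H S) = here refl

mutual
  subterms-trans : ∀ {a k x} (M : Tm a) {s : Tm k} → (k , s) ∈ subterms M → x ∈ subterms s → x ∈ subterms M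
  subterms-trans (lam M) (here refl) x∈ = x∈
  subterms-trans (lam M) (there s∈) x∈ = there (subterms-trans M s∈ x∈)
  subterms-trans (neu H S) (here refl) x∈ = x∈
  subterms-trans (neu H S) (there s∈) x∈ = there (subtermsSp-trans S s∈ x∈)

  subtermsSp-trans : ∀ {a k x} (S : Spine a) {s : Tm k} → (k , s) ∈ subtermsSp S → x ∈ subterms s → x ∈ subtermsSp S
  subtermsSp-trans (app M S) s∈ x∈ with ∈-++⁻ (subterms M) s∈
  ... | inj₁ s∈M = ∈-++⁺ˡ (subterms-trans M s∈M x∈)
  ... | inj₂ s∈S = ∈-++⁺ʳ (subterms M) (subtermsSp-trans S s∈S x∈)
  subtermsSp-trans (pv x S) s∈ x∈ = subtermsSp-trans S s∈ x∈

_∈ᴿ_ : ∀ {n} → Tm n → List SomeTm → Set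
_∈ᴿ_ {n} t ts = Σ ℕ λ m → Σ (Tm m) λ s → (m , s) ∈ ts × Σ (Ren m n) λ ρ → renTm ρ s ≡ t

Pattern : Set
Pattern = Σ ℕ λ K → Tm K × Tm K

renamingsInto : ∀ K → SomeTm → SomeTm → List Pattern
renamingsInto K (m₁ , t₁) (m₂ , t₂) =
  map (λ f → K , renTm (f ∘ (_↑ˡ m₂)) t₁ , renTm (f ∘ (m₁ ↑ʳ_)) t₂) (functions (m₁ + m₂) K)

patterns : List SomeTm → List Pattern
patterns ts = concatMap (uncurry pairPatterns) (cartesianProduct ts ts)
  where
  pairPatterns : SomeTm → SomeTm → List Pattern
  pairPatterns (m₁ , t₁) (m₂ , t₂) =
    renamingsInto (m₁ + m₂) (m₁ , t₁) (m₂ , t₂) ++ renamingsInto (suc (m₁ + m₂)) (m₁ , t₁) (m₂ , t₂)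

∈-patterns : ∀ {ts K m₁ m₂} {t₁ : Tm m₁} {t₂ : Tm m₂} {g : Ren (m₁ + m₂) K} →
             (m₁ , t₁) ∈ ts → (m₂ , t₂) ∈ ts → K ≡ m₁ + m₂ ⊎ K ≡ suc (m₁ + m₂) → g ∈ functions (m₁ + m₂) K →
             (K , renTm (g ∘ (_↑ˡ m₂)) t₁ , renTm (g ∘ (m₁ ↑ʳ_)) t₂) ∈ patterns ts
∈-patterns t₁∈ t₂∈ (inj₁ refl) g∈ =
  ∈-concatMap⁺ (uncurry _) (lose (∈-cartesianProduct⁺ t₁∈ t₂∈) (∈-++⁺ˡ (∈-map⁺ _ g∈)))
∈-patterns t₁∈ t₂∈ (inj₂ refl) g∈ =
  ∈-concatMap⁺ (uncurry _) (lose (∈-cartesianProduct⁺ t₁∈ t₂∈) (∈-++⁺ʳ _ (∈-map⁺ _ g∈)))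

pattern-for : ∀ ts {n} {u₁ u₂ : Tm n} → u₁ ∈ᴿ ts → u₂ ∈ᴿ ts →
              ∃ λ ((K , p₁ , p₂) : Pattern) → (K , p₁ , p₂) ∈ patterns ts ×
                ∀ Δ → Assumed Δ u₁ u₂ ⇔ Assumed Δ p₁ p₂
pattern-for ts {n} (m₁ , t₁ , t₁∈ , ρ₁ , refl) (m₂ , t₂ , t₂∈ , ρ₂ , refl) =
  _ , ∈-patterns t₁∈ t₂∈ size-bound (proj₁ (proj₂ enumerated)) ,
  λ Δ → mk⇔ (Assumed-reindex back (through-back (lookup-++ˡ ρ₁ ρ₂)) (through-back (lookup-++ʳ ρ₁ ρ₂)))
            (Assumed-reindex out (through-out (lookup-++ˡ ρ₁ ρ₂)) (through-out (lookup-++ʳ ρ₁ ρ₂)))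
  where
  ρ : Ren (m₁ + m₂) n
  ρ = ρ₁ Vec.++ ρ₂

  open Factorisation (factorise ρ)

  enumerated : ∃ λ g → g ∈ functions (m₁ + m₂) size × back ∘ ρ ≗ g
  enumerated = functions-complete (back ∘ ρ)

  g : Ren (m₁ + m₂) size
  g = proj₁ enumerated

  back∘ρ≗g : back ∘ ρ ≗ g
  back∘ρ≗g = proj₂ (proj₂ enumerated)

  through-back : ∀ {m} {ι : Ren m (m₁ + m₂)} {ρᵢ : Ren m n} → ρ ∘ ι ≗ ρᵢ → back ∘ ρᵢ ≗ g ∘ ι
  through-back ρ∘ι≗ρᵢ i = trans (cong back (sym (ρ∘ι≗ρᵢ i))) (back∘ρ≗g _)

  through-out : ∀ {m} {ι : Ren m (m₁ + m₂)} {ρᵢ : Ren m n} → ρ ∘ ι ≗ ρᵢ → out ∘ g ∘ ι ≗ ρᵢ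
  through-out ρ∘ι≗ρᵢ i = trans (cong out (sym (back∘ρ≗g _))) (trans (retract _) (ρ∘ι≗ρᵢ i))


uncovered : List Assumption → List Pattern → ℕ
uncovered Δ [] = 0
uncovered Δ ((K , p₁ , p₂) ∷ ps) with assumed? Δ p₁ p₂
... | yes _ = uncovered Δ ps
... | no _ = suc (uncovered Δ ps)

uncovered-∷-≤ : ∀ {a} Δ ps → uncovered (a ∷ Δ) ps ≤ uncovered Δ ps
uncovered-∷-≤ Δ [] = z≤n
uncovered-∷-≤ {a} Δ ((K , p₁ , p₂) ∷ ps) with assumed? Δ p₁ p₂ | assumed? (a ∷ Δ) p₁ p₂
... | yes _ | yes _ = uncovered-∷-≤ Δ ps
... | yes h | no ¬h = ⊥-elim (¬h (Assumed-∷ h))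
... | no _ | yes _ = m≤n⇒m≤1+n (uncovered-∷-≤ Δ ps)
... | no _ | no _ = s≤s (uncovered-∷-≤ Δ ps)

uncovered-∷-< : ∀ {a} Δ ps {K} {p₁ p₂ : Tm K} → (K , p₁ , p₂) ∈ ps →
                ¬ Assumed Δ p₁ p₂ → Assumed (a ∷ Δ) p₁ p₂ → uncovered (a ∷ Δ) ps < uncovered Δ ps
uncovered-∷-< {a} Δ ((K , p₁ , p₂) ∷ ps) (here refl) ¬h h′ with assumed? Δ p₁ p₂ | assumed? (a ∷ Δ) p₁ p₂
... | yes h | _ = ⊥-elim (¬h h)
... | no _ | no ¬h′ = ⊥-elim (¬h′ h′)
... | no _ | yes _ = s≤s (uncovered-∷-≤ Δ ps)
uncovered-∷-< {a} Δ ((K , q₁ , q₂) ∷ ps) (there p∈) ¬h h′ with assumed? Δ q₁ q₂ | assumed? (a ∷ Δ) q₁ q₂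
... | yes _ | yes _ = uncovered-∷-< Δ ps p∈ ¬h h′
... | yes h | no ¬h″ = ⊥-elim (¬h″ (Assumed-∷ h))
... | no _ | yes _ = m≤n⇒m≤1+n (uncovered-∷-< Δ ps p∈ ¬h h′)
... | no _ | no _ = s≤s (uncovered-∷-< Δ ps p∈ ¬h h′)

hred-prepat : ∀ {k n} τ (S : Spine n) (M : Tm k) (ρ : Ren k n) {T} → Prepat S →
              hred τ S (renTm ρ M) ≡ just T → T ∈ᴿ subterms M
hred-prepat * nil (neu H S) ρ nil refl = _ , _ , here refl , ρ , refl
hred-prepat (* ⇒ τ) (pv y S) (lam M) ρ (pv pp) e
  with hred-prepat τ S M (single y ∘ liftR ρ) pp (trans (cong (hred τ S) (sym (renTm-comp (λ _ → refl) M))) e)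
... | m , s , s∈ , ρ' , renames = m , s , there s∈ , ρ' , renames
hred-prepat * nil (lam M) ρ nil ()
hred-prepat (_ ⇒ _) nil M ρ nil ()
hred-prepat * (pv y S) M ρ (pv pp) ()
hred-prepat (* ⇒ τ) (pv y S) (neu H S₀) ρ (pv pp) ()
hred-prepat ((_ ⇒ _) ⇒ τ) (pv y S) M ρ (pv pp) ()

¬NotRec-rcon : ∀ {n r} → ¬ NotRec {n} (rcon r)
¬NotRec-rcon ()

nothing≢just : ∀ {A : Set} {x : A} → nothing ≢ just x
nothing≢just ()

bodies : Signature → List SomeTm
bodies [] = []
bodies (recDecl r A M ∷ Sg) = (0 , M) ∷ bodies Sg
bodies (famDecl _ _ ∷ Sg) = bodies Sg
bodies (conDecl _ _ ∷ Sg) = bodies Sg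

∈-bodies : ∀ {Sg r A M} → recDecl r A M ∈ Sg → (0 , M) ∈ bodies Sg
∈-bodies {recDecl _ _ _ ∷ Sg} (here refl) = here refl
∈-bodies {recDecl _ _ _ ∷ Sg} (there d∈) = there (∈-bodies d∈)
∈-bodies {famDecl _ _ ∷ Sg} (there d∈) = ∈-bodies d∈
∈-bodies {conDecl _ _ ∷ Sg} (there d∈) = ∈-bodies d∈

module _ (Sg : Signature) where

  data UnfoldsVia {n : ℕ} (S : Spine n) (r : ℕ) (G : Tm n → Set) : Decl → Set where
    via : ∀ {A M T} → Contra M → hred (erase A) S (weaken0 M) ≡ just T → G T →
          UnfoldsVia S r G (recDecl r A M)

  Unfolds : ∀ {n} → Spine n → ℕ → (Tm n → Set) → Set
  Unfolds S r G = ∃ λ d → d ∈ Sg × UnfoldsVia S r G d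

  data View (Δ : List Assumption) (n : ℕ) : Head n → Spine n → Head n → Spine n → Set where
    vHyp     : ∀ {H S H' S'} → Assumed Δ (neu H S) (neu H' S') → View Δ n H S H' S'
    vUnfoldL : ∀ {r S H' S'} → Prepat S →
               Unfolds S r (λ T → EqTm Sg (asm n (rcon r) S H' S' ∷ Δ) n T (neu H' S')) →
               View Δ n (rcon r) S H' S'
    vUnfoldR : ∀ {H S r S'} → Prepat S' → NotRec H →
               Unfolds S' r (λ T → EqTm Sg (asm n H S (rcon r) S' ∷ Δ) n (neu H S) T) →
               View Δ n H S (rcon r) S'
    vCon     : ∀ {c S S'} → EqSp Sg Δ n S S' → View Δ n (con c) S (con c) S'
    vVar     : ∀ {y S S'} → EqSp Sg Δ n S S' → View Δ n (var y) S (var y) S'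

  view : ∀ {Δ n H S H' S'} → EqTm Sg Δ n (neu H S) (neu H' S') → View Δ n H S H' S'
  view (eq-hyp a∈ σ) = vHyp (assumed a∈ σ refl refl)
  view (eq-unfoldL d∈ pp ct e q) = vUnfoldL pp (_ , d∈ , via ct e q)
  view (eq-unfoldR d∈ pp ct nr e q) = vUnfoldR pp nr (_ , d∈ , via ct e q)
  view (eq-con q) = vCon q
  view (eq-var q) = vVar q

  unview : ∀ {Δ n H S H' S'} → View Δ n H S H' S' → EqTm Sg Δ n (neu H S) (neu H' S')
  unview (vHyp (assumed a∈ σ refl refl)) = eq-hyp a∈ σ
  unview (vUnfoldL pp (_ , d∈ , via ct e q)) = eq-unfoldL d∈ pp ct e q
  unview (vUnfoldR pp nr (_ , d∈ , via ct e q)) = eq-unfoldR d∈ pp ct nr e q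
  unview (vCon q) = eq-con q
  unview (vVar q) = eq-var q

  module Decision (roots : List SomeTm) where

    universe : List SomeTm
    universe = concatMap (subterms ∘ proj₂) (roots ++ bodies Sg)

    universe-subterms : ∀ {k} {s : Tm k} {x} → (k , s) ∈ universe → x ∈ subterms s → x ∈ universe
    universe-subterms s∈ x∈ = ∈-concatMap⁺ (subterms ∘ proj₂)
      (Any.map (λ { {_ , M} s∈M → subterms-trans M s∈M x∈ })
               (∈-concatMap⁻ (subterms ∘ proj₂) {xs = roots ++ bodies Sg} s∈))

    root∈universe : ∀ {k} {s : Tm k} → (k , s) ∈ roots ++ bodies Sg → (k , s) ∈ universe
    root∈universe {s = s} s∈ = ∈-concatMap⁺ (subterms ∘ proj₂) (lose s∈ (∈-subterms-self s))

    Reachable : ∀ {n} → Tm n → Set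
    Reachable t = t ∈ᴿ universe

    data ReachableSp {n : ℕ} : Spine n → Set where
      nil : ReachableSp nil
      app : ∀ {M S} → Reachable M → ReachableSp S → ReachableSp (app M S)
      pv  : ∀ {x S} → ReachableSp S → ReachableSp (pv x S)

    Reachable-root : ∀ {n} {M : Tm n} → (n , M) ∈ roots → Reachable M
    Reachable-root {M = M} M∈ = _ , M , root∈universe (∈-++⁺ˡ M∈) , (λ i → i) , renTm-id (λ _ → refl) M

    Reachable-lam : ∀ {n} {M : Tm (suc n)} → Reachable (lam M) → Reachable M
    Reachable-lam (m , lam s , s∈ , ρ , refl) =
      suc m , s , universe-subterms s∈ (there (∈-subterms-self s)) , liftR ρ , refl

    Reachable-neu : ∀ {n H} {S : Spine n} → Reachable (neu H S) → ReachableSp S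
    Reachable-neu (m , neu H₀ S₀ , s∈ , ρ , refl) = spine S₀ (λ x∈ → universe-subterms s∈ (there x∈))
      where
      spine : ∀ S → (∀ {x} → x ∈ subtermsSp S → x ∈ universe) → ReachableSp (renSp ρ S)
      spine nil _ = nil
      spine (app M S) ⊆ = app (_ , M , ⊆ (∈-++⁺ˡ (∈-subterms-self M)) , ρ , refl)
                              (spine S (⊆ ∘ ∈-++⁺ʳ (subterms M)))
      spine (pv x S) ⊆ = pv (spine S ⊆)

    Reachable-unfold : ∀ {n r A M T} {S : Spine n} → recDecl r A M ∈ Sg → Prepat S →
                       hred (erase A) S (weaken0 M) ≡ just T → Reachable T
    Reachable-unfold {A = A} {M} {S = S} d∈ pp e with hred-prepat (erase A) S M _ pp e
    ... | m , s , s∈ , ρ , renames =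
      m , s , universe-subterms (root∈universe (∈-++⁺ʳ roots (∈-bodies d∈))) s∈ , ρ , renames

    unfolds? : ∀ {n} {S : Spine n} {r} {G : Tm n → Set} → Prepat S →
               (∀ {T} → Reachable T → Dec (G T)) → Dec (Unfolds S r G)
    unfolds? {S = S} {r} {G} pp G? = ∃∈? Sg via?
      where
      via? : ∀ {d} → d ∈ Sg → Dec (UnfoldsVia S r G d)
      via? {famDecl _ _} _ = no λ ()
      via? {conDecl _ _} _ = no λ ()
      via? {recDecl r' A M} d∈ with r' ℕ.≟ r | contra? M | hred (erase A) S (weaken0 M) in e
      ... | no r'≢r | _ | _ = no λ { (via _ _ _) → r'≢r refl }
      ... | yes _ | no ¬ct | _ = no λ { (via ct _ _) → ¬ct ct }
      ... | yes refl | yes ct | nothing = no λ { (via _ e' _) → nothing≢just (trans (sym e) e') }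
      ... | yes refl | yes ct | just T =
        map′ (via ct e) (λ { (via _ e' g) → subst G (just-injective (trans (sym e') e)) g })
             (G? (Reachable-unfold d∈ pp e))

    patternsOfUniverse : List Pattern
    patternsOfUniverse = patterns universe

    uncovered-decreases : ∀ {Δ n H S H' S'} → Reachable (neu H S) → Reachable (neu H' S') →
                          ¬ Assumed Δ (neu H S) (neu H' S') →
                          uncovered (asm n H S H' S' ∷ Δ) patternsOfUniverse < uncovered Δ patternsOfUniverse
    uncovered-decreases {Δ} reach₁ reach₂ fresh with pattern-for universe reach₁ reach₂
    ... | _ , p∈ , same = uncovered-∷-< Δ patternsOfUniverse p∈
                            (fresh ∘ Equivalence.from (same Δ)) (Equivalence.to (same _) Assumed-head)

    Fuel : List Assumption → Set
    Fuel Δ = Acc _<_ (uncovered Δ patternsOfUniverse)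

    mutual
      eqTm? : ∀ Δ → Fuel Δ → ∀ {n} (M M' : Tm n) → Reachable M → Reachable M' → Dec (EqTm Sg Δ n M M')
      eqTm? Δ fuel (lam M) (lam M') reach reach' =
        map′ eq-lam (λ { (eq-lam q) → q }) (eqTm? Δ fuel M M' (Reachable-lam reach) (Reachable-lam reach'))
      eqTm? Δ fuel (neu H S) (neu H' S') reach reach' = map′ unview view (view? Δ fuel H S H' S' reach reach')
      eqTm? Δ fuel (lam _) (neu _ _) _ _ = no λ ()
      eqTm? Δ fuel (neu _ _) (lam _) _ _ = no λ ()

      eqSp? : ∀ Δ → Fuel Δ → ∀ {n} (S S' : Spine n) → ReachableSp S → ReachableSp S' → Dec (EqSp Sg Δ n S S')
      eqSp? Δ fuel nil nil _ _ = yes eq-nil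
      eqSp? Δ fuel (app M S) (app M' S') (app reachM reachS) (app reachM' reachS') =
        map′ (uncurry eq-app) (λ { (eq-app p q) → p , q })
             (eqTm? Δ fuel M M' reachM reachM' ×-dec eqSp? Δ fuel S S' reachS reachS')
      eqSp? Δ fuel (pv x S) (pv y S') (pv reach) (pv reach') with x Fin.≟ y
      ... | yes refl = map′ eq-pv (λ { (eq-pv q) → q }) (eqSp? Δ fuel S S' reach reach')
      ... | no x≢y = no λ { (eq-pv _) → x≢y refl }
      eqSp? Δ fuel nil (app _ _) _ _ = no λ ()
      eqSp? Δ fuel nil (pv _ _) _ _ = no λ ()
      eqSp? Δ fuel (app _ _) nil _ _ = no λ ()
      eqSp? Δ fuel (app _ _) (pv _ _) _ _ = no λ ()
      eqSp? Δ fuel (pv _ _) nil _ _ = no λ ()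
      eqSp? Δ fuel (pv _ _) (app _ _) _ _ = no λ ()

      view? : ∀ Δ → Fuel Δ → ∀ {n} (H : Head n) S H' S' → Reachable (neu H S) → Reachable (neu H' S') →
              Dec (View Δ n H S H' S')
      view? Δ fuel H S H' S' reach reach' with assumed? Δ (neu H S) (neu H' S')
      ... | yes h = yes (vHyp h)
      ... | no fresh = freshView? Δ fuel H S H' S' reach reach' fresh

      freshView? : ∀ Δ → Fuel Δ → ∀ {n} (H : Head n) S H' S' → Reachable (neu H S) → Reachable (neu H' S') →
                   ¬ Assumed Δ (neu H S) (neu H' S') → Dec (View Δ n H S H' S')
      freshView? Δ (acc smaller) {n} (rcon r) S H' S' reach reach' fresh with prepat? S
      ... | no ¬pp = no λ { (vHyp h) → fresh h ; (vUnfoldL pp _) → ¬pp pp ; (vUnfoldR _ () _) }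
      ... | yes pp =
        map′ (vUnfoldL pp) (λ { (vHyp h) → ⊥-elim (fresh h) ; (vUnfoldL _ u) → u ; (vUnfoldR _ () _) })
             (unfolds? pp λ reachT → eqTm? (asm n (rcon r) S H' S' ∷ Δ)
                                            (smaller (uncovered-decreases reach reach' fresh))
                                            _ (neu H' S') reachT reach')
      freshView? Δ fuel (con c) S (con c') S' reach reach' fresh with c ℕ.≟ c'
      ... | yes refl = map′ vCon (λ { (vHyp h) → ⊥-elim (fresh h) ; (vCon q) → q })
                            (eqSp? Δ fuel S S' (Reachable-neu reach) (Reachable-neu reach'))
      ... | no c≢c' = no λ { (vHyp h) → fresh h ; (vCon _) → c≢c' refl }
      freshView? Δ fuel (var x) S (var y) S' reach reach' fresh with x Fin.≟ y
      ... | yes refl = map′ vVar (λ { (vHyp h) → ⊥-elim (fresh h) ; (vVar q) → q })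
                            (eqSp? Δ fuel S S' (Reachable-neu reach) (Reachable-neu reach'))
      ... | no x≢y = no λ { (vHyp h) → fresh h ; (vVar _) → x≢y refl }
      freshView? Δ fuel (con c) S (var y) S' reach reach' fresh = no λ { (vHyp h) → fresh h }
      freshView? Δ fuel (var x) S (con c) S' reach reach' fresh = no λ { (vHyp h) → fresh h }
      freshView? Δ fuel (con c) S (rcon r) S' reach reach' fresh =
        unfoldRight? Δ fuel con S r S' reach reach' fresh
      freshView? Δ fuel (var x) S (rcon r) S' reach reach' fresh =
        unfoldRight? Δ fuel var S r S' reach reach' fresh

      unfoldRight? : ∀ Δ → Fuel Δ → ∀ {n} {H : Head n} → NotRec H → ∀ S r S' →
                     Reachable (neu H S) → Reachable (neu (rcon r) S') → ¬ Assumed Δ (neu H S) (neu (rcon r) S') →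
                     Dec (View Δ n H S (rcon r) S')
      unfoldRight? Δ (acc smaller) {n} {H} nr S r S' reach reach' fresh with prepat? S'
      ... | no ¬pp =
        no λ { (vHyp h) → fresh h ; (vUnfoldL _ _) → ¬NotRec-rcon nr ; (vUnfoldR pp _ _) → ¬pp pp }
      ... | yes pp =
        map′ (vUnfoldR pp nr)
             (λ { (vHyp h) → ⊥-elim (fresh h) ; (vUnfoldL _ _) → ⊥-elim (¬NotRec-rcon nr) ; (vUnfoldR _ _ u) → u })
             (unfolds? pp λ reachT → eqTm? (asm n H S (rcon r) S' ∷ Δ)
                                            (smaller (uncovered-decreases reach reach' fresh))
                                            (neu H S) _ reach reachT)

theorem1 : (Sg : Signature) → WellScopedSig Sg →
           (n : ℕ) (Δ : List Assumption) (M M' : Tm n) →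
           RatTm Sg M → RatTm Sg M' →
           Dec (EqTm Sg Δ n M M')
theorem1 Sg _ n Δ M M' _ _ =
  eqTm? Δ (<-wellFounded _) M M' (Reachable-root (here refl)) (Reachable-root (there (here refl)))
  where open Decision Sg ((n , M) ∷ (n , M') ∷ [])
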